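{- Let $L$ be a lattice data structure with $N$ proper keys. Then each of the algorithms SearchLDS (for any positive integer $K$), Inward and Outward (started at any cell $C$ of $L$ not lying in row $1$, column $1$ or diagonal $h+3$, where $h$ is the height of $L$) terminates in time $O(\sqrt{N})$.
   Context: Diagram of height $h$: cells $(r,c)$ of positive integers with $r+c\le h+4$; $r$ is the row (numbered bottom to top), $c$ the column (left to right). Diagonal $k$ ($1\le k\le h+3$) is the set of cells with $r+c=k+1$, numbered from head $(k,1)$ to tail $(1,k)$, its $j$-th cell being $(k+1-j,j)$. A lattice data structure (LDS) of height $h$ assigns to each cell an entry in $\{0,\infty\}\cup\mathbb{Z}_{>0}$ such that: (1) all cells of row $1$ and column $1$ contain $0$; (2) all cells of diagonal $h+3$ except head and tail contain $\infty$; (3) for some $0\le m\le h-1$, exactly the cells $(h+3-j,j)$ of diagonal $h+2$ with $h+2-m\le j\le h+1$ contain $\infty$; (4) all remaining cells contain pairwise distinct positive integers (proper keys); (5) proper keys are strictly increasing along each row (left to right), column (bottom to top) and diagonal (head to tail). Order convention: $0<n<\infty$ for every positive integer $n$; cells are compared via their entries. For a cell $C=(r,c)$ write $D=(r-1,c)$, $U=(r+1,c)$, $UL=(r+1,c-1)$, $DR=(r-1,c+1)$. SearchLDS($L,K$): start at cell $(h+1,2)$; repeatedly, if the current entry equals $K$ stop ($K$ present), if it equals $0$ stop ($K$ absent), otherwise move to $DR$ if $K$ is greater than the entry and to $D$ if $K$ is smaller. Inward($L,C$): while ($C<D$ or $C<UL$): if $UL>D$, swap the entries of $UL$ and $C$,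 otherwise swap the entries of $D$ and $C$; in either case $C$ thereafter denotes the cell into which the original entry of $C$ was moved. Outward($L,C$): while ($C>U$ or ($C>DR$ and $DR\ne0$)): if $DR<U$ and $DR\neq 0$, swap the entries of $DR$ and $C$, otherwise swap the entries of $U$ and $C$; in either case $C$ thereafter denotes the cell into which the original entry of $C$ was moved. -}

module Defs where

open import Data.Nat using (ℕ; zero; suc; _+_; _*_; _∸_; _≤_; _<_; _≡ᵇ_; _<ᵇ_)
open import Data.Bool using (Bool; true; false; if_then_else_; _∨_; _∧_; not)
open import Data.List using (List; map; concatMap; upTo; filter; length)
open import Data.Maybe using (Maybe; just; nothing)
open import Data.Product using (_×_; _,_; Σ; ∃; proj₁; proj₂)
open import Data.Bool.Properties using (T?)
open import Data.Sum using (_⊎_)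
open import Data.Unit using (⊤)
open import Data.Empty using (⊥)
open import Relation.Binary.PropositionalEquality using (_≡_)
open import Function.Bundles using (_⇔_)
open import Relation.Nullary using (¬_)
open import Data.Bool using (T)

data Entry : Set where
  zer : Entry
  inf : Entry
  key : ℕ → Entry

_<ᴱ_ : Entry → Entry → Bool
zer   <ᴱ zer   = false
zer   <ᴱ _     = true
inf   <ᴱ _     = false
key n <ᴱ zer   = false
key n <ᴱ inf   = true
key n <ᴱ key m = n <ᵇ m

isZer : Entry → Bool
isZer zer = true
isZer _   = false

isKey : Entry → Bool
isKey (key _) = true
isKey _       = false

-- A filling of the plane: L r c is the entry of cell (r , c)
-- (row r counted bottom to top, column c left to right; only cells of the
-- diagram are constrained).
Filling : Set
Filling = ℕ → ℕ → Entry

InDiagram : ℕ → ℕ → ℕ → Set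
InDiagram h r c = (1 ≤ r) × (1 ≤ c) × (r + c ≤ h + 4)

cells : ℕ → List (ℕ × ℕ)
cells h = concatMap (λ r → map (λ c → (suc r , suc c)) (upTo (h + 3 ∸ r))) (upTo (h + 3))

numKeys : ℕ → Filling → ℕ
numKeys h L = length (filter (λ rc → T? (isKey (L (proj₁ rc) (proj₂ rc)))) (cells h))

-- cells required to hold proper keys (condition (4)), given m:
-- in the diagram, not in row 1 / column 1, not on diagonal h+3, and not one of
-- the ∞-cells (h+3-j , j), h+2-m ≤ j ≤ h+1, of diagonal h+2.
KeyCell : ℕ → ℕ → ℕ → ℕ → Set
KeyCell h m r c = (2 ≤ r) × (2 ≤ c) × (r + c ≤ h + 3) × ¬ ((r + c ≡ h + 3) × (h + 2 ∸ m ≤ c))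

record IsLDSWith (h m : ℕ) (L : Filling) : Set where
  field
    m<h     : m < h
    row1    : ∀ c → 1 ≤ c → 1 + c ≤ h + 4 → L 1 c ≡ zer
    col1    : ∀ r → 1 ≤ r → r + 1 ≤ h + 4 → L r 1 ≡ zer
    -- (2) diagonal h+3 except head and tail: cells (h+4-j , j), 2 ≤ j ≤ h+2
    diag∞   : ∀ j → 2 ≤ j → j ≤ h + 2 → L (h + 4 ∸ j) j ≡ inf
    diag2∞  : ∀ j → 2 ≤ j → j ≤ h + 1 → (h + 2 ∸ m ≤ j) → L (h + 3 ∸ j) j ≡ inf
    keys    : ∀ r c → KeyCell h m r c → Σ ℕ λ n → (0 < n) × (L r c ≡ key n)
    distinct : ∀ r c r' c' n → KeyCell h m r c → KeyCell h m r' c' →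
               L r c ≡ key n → L r' c' ≡ key n → (r ≡ r') × (c ≡ c')
    incRow  : ∀ r c c' n n' → KeyCell h m r c → KeyCell h m r c' → c < c' →
              L r c ≡ key n → L r c' ≡ key n' → n < n'
    incCol  : ∀ r r' c n n' → KeyCell h m r c → KeyCell h m r' c → r < r' →
              L r c ≡ key n → L r' c ≡ key n' → n < n'
    incDiag : ∀ r c r' c' n n' → KeyCell h m r c → KeyCell h m r' c' →
              r + c ≡ r' + c' → c < c' →
              L r c ≡ key n → L r' c' ≡ key n' → n < n'

IsLDS : ℕ → Filling → Set
IsLDS h L = Σ ℕ λ m → IsLDSWith h m L

-- Running a loop: a step function returns nothing when the loop stops.
-- HaltsWithin step n s : starting from s, the loop stops after at most n
-- iterations of its body.

HaltsWithin : {S : Set} → (S → Maybe S) → ℕ → S → Set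
HaltsWithin step zero s with step s
... | nothing = ⊤
... | just _  = ⊥
HaltsWithin step (suc n) s with step s
... | nothing = ⊤
... | just s' = HaltsWithin step n s'

searchStep : Filling → ℕ → ℕ × ℕ → Maybe (ℕ × ℕ)
searchStep L K (r , c) with L r c
... | zer   = nothing
... | inf   = just (r ∸ 1 , c)
... | key n = if n ≡ᵇ K then nothing
              else if n <ᵇ K then just (r ∸ 1 , suc c)
              else just (r ∸ 1 , c)

searchStart : ℕ → ℕ × ℕ
searchStart h = (h + 1 , 2)

swap : Filling → ℕ × ℕ → ℕ × ℕ → Filling
swap L (r₁ , c₁) (r₂ , c₂) r c =
  if (r ≡ᵇ r₁) ∧ (c ≡ᵇ c₁) then L r₂ c₂
  else if (r ≡ᵇ r₂) ∧ (c ≡ᵇ c₂) then L r₁ c₁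
  else L r c

IOState : Set
IOState = Filling × ℕ × ℕ

inwardStep : IOState → Maybe IOState
inwardStep (L , r , c) =
  if (C <ᴱ D) ∨ (C <ᴱ UL)
  then (if D <ᴱ UL
        then just (swap L (r , c) (suc r , c ∸ 1) , suc r , c ∸ 1)
        else just (swap L (r , c) (r ∸ 1 , c) , r ∸ 1 , c))
  else nothing
  where
  C  = L r c
  D  = L (r ∸ 1) c
  UL = L (suc r) (c ∸ 1)

outwardStep : IOState → Maybe IOState
outwardStep (L , r , c) =
  if (U <ᴱ C) ∨ ((DR <ᴱ C) ∧ not (isZer DR))
  then (if (DR <ᴱ U) ∧ not (isZer DR)
        then just (swap L (r , c) (r ∸ 1 , suc c) , r ∸ 1 , suc c)
        else just (swap L (r , c) (suc r , c) , suc r , c))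
  else nothing
  where
  C  = L r c
  U  = L (suc r) c
  DR = L (r ∸ 1) (suc c)

ValidStart : ℕ → ℕ → ℕ → Set
ValidStart h r c = (2 ≤ r) × (2 ≤ c) × (r + c ≤ h + 3)

-- Each loop moves a cursor through the diagram and is controlled by a potential bounded by
-- 3 (h + 3): SearchLDS lowers the row at every step, Inward lowers the weight 2 (r + c) + c of
-- the cell holding the moving entry, and Outward raises it.  The cursor never leaves the inner
-- cells: Inward only moves to a neighbour that exceeds some entry, hence is not a 0 of row or
-- column 1, and Outward only moves to a neighbour that is nonzero, resp. smaller than some
-- entry, hence not an ∞ of diagonal h + 3; swapping two inner cells leaves this frame intact.
-- Conversely every cell (r , c) with r , c ≥ 2 and r + c ≤ h + 2, and the head of diagonal
-- h + 2, holds a key, so N ≥ h (h − 1) / 2 + 1 ≥ h² / 4 and 3 (h + 3) ≤ 12 h ≤ 24 √N.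

module Submission where

open import Defs
open import Data.Nat using (ℕ; zero; suc; _+_; _*_; _∸_; _≤_; _<_; _≡ᵇ_; _<ᵇ_; z≤n; s≤s; s<s; z<s)
open import Data.Nat.Properties
open import Data.Nat.Tactic.RingSolver using (solve-∀)
open import Data.Bool using (true; false; T; _∧_)
open import Data.Bool.Properties using (T?; T-≡)
open import Data.Maybe using (Maybe; just; nothing)
open import Data.Maybe.Relation.Unary.All using (All; just; nothing)
import Data.Maybe.Relation.Unary.All as Maybe
open import Data.List using (List; _∷_; _++_; map; concatMap; applyUpTo; upTo; filter; length)
open import Data.Nat.ListAction using (sum)
open import Data.List.Properties using (filter-accept; filter-++; length-++; map-upTo)
import Data.List.Relation.Unary.All as List
open import Data.List.Relation.Unary.All.Properties using (applyUpTo⁺₁)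
open import Data.List.Membership.Propositional using (_∈_)
open import Data.List.Membership.Propositional.Properties using (∈-upTo⁺)
open import Data.List.Relation.Unary.Any using (here; there)
open import Data.Product using (Σ; _×_; _,_; proj₁; proj₂)
open import Data.Sum using (inj₁; inj₂)
open import Data.Unit using (tt)
open import Data.Empty using (⊥-elim)
open import Function using (_∘_; id)
open import Function.Bundles using (Equivalence)
open import Level using (0ℓ)
open import Relation.Binary.PropositionalEquality
open import Relation.Nullary using (yes; no)
open import Relation.Unary using (Pred; Decidable)

module _ {S : Set} (step : S → Maybe S) (Inv : Pred S 0ℓ) (μ : S → ℕ)
  (decreasing : ∀ {s} → Inv s → All (λ s′ → Inv s′ × μ s′ < μ s) (step s)) where

  halts-by-potential : ∀ n {s} → Inv s → μ s ≤ n → HaltsWithin step n s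
  halts-by-potential zero {s} inv μ≤0 with step s | decreasing inv
  ... | nothing | _ = tt
  ... | just _  | just (_ , μ′<μ) = ⊥-elim (n≮0 (≤-trans μ′<μ μ≤0))
  halts-by-potential (suc n) {s} inv μ≤1+n with step s | decreasing inv
  ... | nothing | _ = tt
  ... | just _  | just (inv′ , μ′<μ) = halts-by-potential n inv′ (≤-pred (≤-trans μ′<μ μ≤1+n))

<ᴱ⇒≢zer : ∀ x y → x <ᴱ y ≡ true → y ≢ zer
<ᴱ⇒≢zer zer     _ () refl
<ᴱ⇒≢zer inf     _ () refl
<ᴱ⇒≢zer (key _) _ () refl

<ᴱ⇒≢inf : ∀ x y → x <ᴱ y ≡ true → x ≢ inf
<ᴱ⇒≢inf _ _ () refl

zer≮ᴱ⇒≡zer : ∀ y → zer <ᴱ y ≡ false → y ≡ zer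
zer≮ᴱ⇒≡zer zer _ = refl

≮ᴱinf⇒≡inf : ∀ x → x <ᴱ inf ≡ false → x ≡ inf
≮ᴱinf⇒≡inf inf _ = refl

isZer⇒≢zer : ∀ {x} → isZer x ≡ false → x ≢ zer
isZer⇒≢zer () refl

≢⇒cell-≡ᵇ-false : ∀ {r c r′ c′} → (r , c) ≢ (r′ , c′) → (r ≡ᵇ r′) ∧ (c ≡ᵇ c′) ≡ false
≢⇒cell-≡ᵇ-false {r} {c} {r′} {c′} ne with r ≡ᵇ r′ in r≡ᵇr′ | c ≡ᵇ c′ in c≡ᵇc′
... | false | _     = refl
... | true  | false = refl
... | true  | true  = ⊥-elim (ne (cong₂ _,_ (≡ᵇ⇒≡ r r′ (Equivalence.from T-≡ r≡ᵇr′))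
                                            (≡ᵇ⇒≡ c c′ (Equivalence.from T-≡ c≡ᵇc′))))

swap-outside : ∀ L p q {r c} → (r , c) ≢ p → (r , c) ≢ q → swap L p q r c ≡ L r c
swap-outside L (r₁ , c₁) (r₂ , c₂) ne₁ ne₂
  rewrite ≢⇒cell-≡ᵇ-false ne₁ | ≢⇒cell-≡ᵇ-false ne₂ = refl

record Boundary (h : ℕ) (L : Filling) : Set where
  field
    row1  : ∀ c → 1 ≤ c → 1 + c ≤ h + 4 → L 1 c ≡ zer
    col1  : ∀ r → 1 ≤ r → r + 1 ≤ h + 4 → L r 1 ≡ zer
    diag∞ : ∀ j → 2 ≤ j → j ≤ h + 2 → L (h + 4 ∸ j) j ≡ inf

open Boundary

boundary : ∀ {h m L} → IsLDSWith h m L → Boundary h L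
boundary I = record { row1 = IsLDSWith.row1 I ; col1 = IsLDSWith.col1 I ; diag∞ = IsLDSWith.diag∞ I }

h+3≤h+4 : ∀ h → h + 3 ≤ h + 4
h+3≤h+4 h = +-monoʳ-≤ h (n≤1+n 3)

row1-inner : ∀ {h L c} → Boundary h L → 1 ≤ c → 1 + c ≤ h + 3 → L 1 c ≡ zer
row1-inner {h} {c = c} B 1≤c 1+c≤ = row1 B c 1≤c (≤-trans 1+c≤ (h+3≤h+4 h))

∞-above-diagonal : ∀ {h L r c} → Boundary h L → 1 ≤ r → 2 ≤ c → r + c ≡ h + 3 → L (suc r) c ≡ inf
∞-above-diagonal {h} {L} {r} {c} B 1≤r 2≤c r+c≡h+3 =
  subst (λ r′ → L r′ c ≡ inf) h+4∸c≡1+r (diag∞ B c 2≤c c≤h+2)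
  where
  h+4∸c≡1+r : h + 4 ∸ c ≡ suc r
  h+4∸c≡1+r = trans (cong (_∸ c) (trans (+-suc h 3) (cong suc (sym r+c≡h+3)))) (m+n∸n≡m (suc r) c)
  c≤h+2 : c ≤ h + 2
  c≤h+2 = ≤-pred (subst (suc c ≤_) (trans r+c≡h+3 (+-suc h 2)) (+-monoˡ-≤ c 1≤r))

boundary-swap : ∀ {h L r₁ c₁ r₂ c₂} → Boundary h L → ValidStart h r₁ c₁ → ValidStart h r₂ c₂ →
                Boundary h (swap L (r₁ , c₁) (r₂ , c₂))
boundary-swap {h} {L} {r₁} {c₁} {r₂} {c₂} B v₁ v₂ = record
  { row1  = λ c 1≤c c≤ → trans (outside (row-1 v₁) (row-1 v₂)) (row1 B c 1≤c c≤)
  ; col1  = λ r 1≤r r≤ → trans (outside (col-1 v₁) (col-1 v₂)) (col1 B r 1≤r r≤)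
  ; diag∞ = λ j 2≤j j≤ → trans (outside (diag j≤ v₁) (diag j≤ v₂)) (diag∞ B j 2≤j j≤)
  }
  where
  outside : ∀ {r c} → (r , c) ≢ (r₁ , c₁) → (r , c) ≢ (r₂ , c₂) → swap L (r₁ , c₁) (r₂ , c₂) r c ≡ L r c
  outside = swap-outside L (r₁ , c₁) (r₂ , c₂)

  row-1 : ∀ {c r′ c′} → ValidStart h r′ c′ → (1 , c) ≢ (r′ , c′)
  row-1 (s≤s () , _) refl

  col-1 : ∀ {r r′ c′} → ValidStart h r′ c′ → (r , 1) ≢ (r′ , c′)
  col-1 (_ , s≤s () , _) refl

  -- a cell of diagonal h + 3 has coordinate sum h + 4, an inner cell at most h + 3
  diag : ∀ {j r′ c′} → j ≤ h + 2 → ValidStart h r′ c′ → (h + 4 ∸ j , j) ≢ (r′ , c′)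
  diag {j} j≤ (_ , _ , r′+c′≤) refl =
    <-irrefl (m∸n+n≡m j≤h+4) (≤-trans (s≤s r′+c′≤) (≤-reflexive (sym (+-suc h 3))))
    where
    j≤h+4 : j ≤ h + 4
    j≤h+4 = ≤-trans j≤ (+-monoʳ-≤ h (≤-trans (n≤1+n 2) (n≤1+n 3)))

stepBound : ℕ → ℕ
stepBound h = 3 * (h + 3)

weight : ℕ → ℕ → ℕ
weight r c = 2 * (r + c) + c

weight-up : ∀ r c → weight r c < weight (suc r) c
weight-up r c = <-≤-trans (m<n+m (weight r c) {2} z<s) (≤-reflexive (sym (weight-suc-r r c)))
  where
  weight-suc-r : ∀ r c → 2 * (suc r + c) + c ≡ 2 + (2 * (r + c) + c)
  weight-suc-r = solve-∀

weight-down-right : ∀ r c → weight (suc r) c < weight r (suc c)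
weight-down-right r c = ≤-reflexive (weight-shift r c)
  where
  weight-shift : ∀ r c → suc (2 * (suc r + c) + c) ≡ 2 * (r + suc c) + suc c
  weight-shift = solve-∀

weight-bound : ∀ r c {n} → r + c ≤ n → weight r c ≤ 3 * n
weight-bound r c {n} r+c≤n = begin
  2 * (r + c) + c        ≤⟨ +-monoʳ-≤ (2 * (r + c)) (m≤n+m c r) ⟩
  2 * (r + c) + (r + c)  ≡⟨ 2s+s≡3s (r + c) ⟩
  3 * (r + c)            ≤⟨ *-monoʳ-≤ 3 r+c≤n ⟩
  3 * n                  ∎
  where
  open ≤-Reasoning
  2s+s≡3s : ∀ s → 2 * s + s ≡ 3 * s
  2s+s≡3s = solve-∀

InnerState : ℕ → IOState → Set
InnerState h (L , r , c) = Boundary h L × ValidStart h r c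

cellWeight : IOState → ℕ
cellWeight (_ , r , c) = weight r c

data InwardMove : IOState → IOState → Set where
  up-left : ∀ {L r c} → L (suc r) (c ∸ 1) ≢ zer →
            InwardMove (L , r , c) (swap L (r , c) (suc r , c ∸ 1) , suc r , c ∸ 1)
  down    : ∀ {L r c} → L (r ∸ 1) c ≢ zer →
            InwardMove (L , r , c) (swap L (r , c) (r ∸ 1 , c) , r ∸ 1 , c)

module _ (L : Filling) (r c : ℕ) where
  private
    C D UL : Entry
    C  = L r c
    D  = L (r ∸ 1) c
    UL = L (suc r) (c ∸ 1)

  inward-moves : All (InwardMove (L , r , c)) (inwardStep (L , r , c))
  inward-moves with C <ᴱ D in C<D | C <ᴱ UL in C<UL | D <ᴱ UL in D<UL
  ... | false | false | _     = nothing
  ... | true  | _     | true  = just (up-left (<ᴱ⇒≢zer D UL D<UL))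
  ... | false | true  | true  = just (up-left (<ᴱ⇒≢zer D UL D<UL))
  ... | true  | _     | false = just (down (<ᴱ⇒≢zer C D C<D))
  ... | false | true  | false = just (down λ D≡0 →
        <ᴱ⇒≢zer C UL C<UL (zer≮ᴱ⇒≡zer UL (subst (λ d → d <ᴱ UL ≡ false) D≡0 D<UL)))

up-left-inner : ∀ {h L} r c → Boundary h L → ValidStart h r c → L (suc r) (c ∸ 1) ≢ zer →
                ValidStart h (suc r) (c ∸ 1) × weight (suc r) (c ∸ 1) < weight r c
up-left-inner r (suc zero) _ (_ , s≤s () , _) _
up-left-inner {h} r (suc (suc zero)) B (_ , _ , r+2≤) UL≢0 =
  ⊥-elim (UL≢0 (col1 B (suc r) (s≤s z≤n)
    (≤-trans (≤-reflexive (sym (+-suc r 1))) (≤-trans r+2≤ (h+3≤h+4 h)))))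
up-left-inner {h} r (suc (suc (suc c))) B (2≤r , _ , r+c≤) _ =
  (m≤n⇒m≤1+n 2≤r , s≤s (s≤s z≤n) , subst (_≤ h + 3) (+-suc r (suc (suc c))) r+c≤) ,
  weight-down-right r (suc (suc c))

down-inner : ∀ {h L} r c → Boundary h L → ValidStart h r c → L (r ∸ 1) c ≢ zer →
             ValidStart h (r ∸ 1) c × weight (r ∸ 1) c < weight r c
down-inner (suc zero) _ _ (s≤s () , _) _
down-inner (suc (suc zero)) c B (_ , 2≤c , 2+c≤) D≢0 = ⊥-elim (D≢0 (row1-inner B (<⇒≤ 2≤c) (<⇒≤ 2+c≤)))
down-inner (suc (suc (suc r))) c B (_ , 2≤c , r+c≤) _ =
  (s≤s (s≤s z≤n) , 2≤c , <⇒≤ r+c≤) , weight-up (suc (suc r)) c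

inward-decreasing : ∀ {h s} → InnerState h s →
                    All (λ s′ → InnerState h s′ × cellWeight s′ < cellWeight s) (inwardStep s)
inward-decreasing {h} {L , r , c} (B , v) = Maybe.map preserved (inward-moves L r c)
  where
  preserved : ∀ {s′} → InwardMove (L , r , c) s′ → InnerState h s′ × cellWeight s′ < weight r c
  preserved (up-left UL≢0) with v′ , lt ← up-left-inner r c B v UL≢0 = (boundary-swap B v v′ , v′) , lt
  preserved (down D≢0)     with v′ , lt ← down-inner r c B v D≢0     = (boundary-swap B v v′ , v′) , lt

inward-halts : ∀ {h L r c} → Boundary h L → ValidStart h r c → HaltsWithin inwardStep (stepBound h) (L , r , c)
inward-halts {h} {L} {r} {c} B v@(_ , _ , r+c≤) =
  halts-by-potential inwardStep (InnerState h) cellWeight inward-decreasing _ (B , v) (weight-bound r c r+c≤)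

data OutwardMove : IOState → IOState → Set where
  down-right : ∀ {L r c} → L (r ∸ 1) (suc c) ≢ zer →
               OutwardMove (L , r , c) (swap L (r , c) (r ∸ 1 , suc c) , r ∸ 1 , suc c)
  up         : ∀ {L r c} → L (suc r) c ≢ inf →
               OutwardMove (L , r , c) (swap L (r , c) (suc r , c) , suc r , c)

module _ (L : Filling) (r c : ℕ) where
  private
    C U DR : Entry
    C  = L r c
    U  = L (suc r) c
    DR = L (r ∸ 1) (suc c)

  outward-moves : All (OutwardMove (L , r , c)) (outwardStep (L , r , c))
  outward-moves with U <ᴱ C in U<C | DR <ᴱ C in DR<C | isZer DR in DR≟0 | DR <ᴱ U in DR<U
  ... | true  | _     | true  | true  = just (up (<ᴱ⇒≢inf U C U<C))
  ... | true  | _     | true  | false = just (up (<ᴱ⇒≢inf U C U<C))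
  ... | true  | _     | false | true  = just (down-right (isZer⇒≢zer DR≟0))
  ... | true  | _     | false | false = just (up (<ᴱ⇒≢inf U C U<C))
  ... | false | true  | false | true  = just (down-right (isZer⇒≢zer DR≟0))
  ... | false | true  | false | false = just (up λ U≡∞ →
        <ᴱ⇒≢inf DR C DR<C (≮ᴱinf⇒≡inf DR (subst (λ u → DR <ᴱ u ≡ false) U≡∞ DR<U)))
  ... | false | true  | true  | _     = nothing
  ... | false | false | _     | _     = nothing

down-right-inner : ∀ {h L} r c → Boundary h L → ValidStart h r c → L (r ∸ 1) (suc c) ≢ zer →
                   ValidStart h (r ∸ 1) (suc c) × weight r c < weight (r ∸ 1) (suc c)
down-right-inner (suc zero) _ _ (s≤s () , _) _
down-right-inner (suc (suc zero)) c B (_ , 2≤c , 2+c≤) DR≢0 = ⊥-elim (DR≢0 (row1-inner B (s≤s z≤n) 2+c≤))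
down-right-inner {h} (suc (suc (suc r))) c B (_ , 2≤c , r+c≤) _ =
  (s≤s (s≤s z≤n) , m≤n⇒m≤1+n 2≤c , subst (_≤ h + 3) (sym (cong (suc ∘ suc) (+-suc r c))) r+c≤) ,
  weight-down-right (suc (suc r)) c

up-inner : ∀ {h L} r c → Boundary h L → ValidStart h r c → L (suc r) c ≢ inf →
           ValidStart h (suc r) c × weight r c < weight (suc r) c
up-inner r c B (2≤r , 2≤c , r+c≤) U≢∞ with m≤n⇒m<n∨m≡n r+c≤
... | inj₁ r+c<  = (m≤n⇒m≤1+n 2≤r , 2≤c , r+c<) , weight-up r c
... | inj₂ r+c≡  = ⊥-elim (U≢∞ (∞-above-diagonal B (<⇒≤ 2≤r) 2≤c r+c≡))

outwardRank : ℕ → IOState → ℕ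
outwardRank h s = stepBound h ∸ cellWeight s

outward-decreasing : ∀ {h s} → InnerState h s →
                     All (λ s′ → InnerState h s′ × outwardRank h s′ < outwardRank h s) (outwardStep s)
outward-decreasing {h} {L , r , c} (B , v) = Maybe.map preserved (outward-moves L r c)
  where
  preserved : ∀ {s′} → OutwardMove (L , r , c) s′ →
              InnerState h s′ × outwardRank h s′ < outwardRank h (L , r , c)
  preserved (down-right DR≢0) with v′ , lt ← down-right-inner r c B v DR≢0 =
    (boundary-swap B v v′ , v′) , ∸-monoʳ-< lt (weight-bound (r ∸ 1) (suc c) (proj₂ (proj₂ v′)))
  preserved (up U≢∞) with v′ , lt ← up-inner r c B v U≢∞ =
    (boundary-swap B v v′ , v′) , ∸-monoʳ-< lt (weight-bound (suc r) c (proj₂ (proj₂ v′)))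

outward-halts : ∀ {h L r c} → Boundary h L → ValidStart h r c → HaltsWithin outwardStep (stepBound h) (L , r , c)
outward-halts {h} {L} {r} {c} B v =
  halts-by-potential outwardStep (InnerState h) (outwardRank h) outward-decreasing _ (B , v) (m∸n≤m _ (weight r c))

data SearchMove (L : Filling) : ℕ × ℕ → ℕ × ℕ → Set where
  down       : ∀ {r c} → isZer (L r c) ≡ false → SearchMove L (r , c) (r ∸ 1 , c)
  down-right : ∀ {r c} → isZer (L r c) ≡ false → SearchMove L (r , c) (r ∸ 1 , suc c)

search-moves : ∀ L K r c → All (SearchMove L (r , c)) (searchStep L K (r , c))
search-moves L K r c with L r c in Lrc
... | zer   = nothing
... | inf   = just (down (cong isZer Lrc))
... | key n with n ≡ᵇ K | n <ᵇ K
...   | true  | _     = nothing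
...   | false | true  = just (down-right (cong isZer Lrc))
...   | false | false = just (down (cong isZer Lrc))

SearchCell : ℕ → ℕ × ℕ → Set
SearchCell h (r , c) = 1 ≤ r × 1 ≤ c × r + c ≤ h + 3

search-decreasing : ∀ {h L K s} → Boundary h L → SearchCell h s →
                    All (λ s′ → SearchCell h s′ × proj₁ s′ < proj₁ s) (searchStep L K s)
search-decreasing {h} {L} {K} {r , c} B v = Maybe.map (preserved r v) (search-moves L K r c)
  where
  preserved : ∀ r {s′} → SearchCell h (r , c) → SearchMove L (r , c) s′ → SearchCell h s′ × proj₁ s′ < r
  preserved (suc zero) (_ , 1≤c , 1+c≤) (down nz)       = ⊥-elim (isZer⇒≢zer nz (row1-inner B 1≤c 1+c≤))
  preserved (suc zero) (_ , 1≤c , 1+c≤) (down-right nz) = ⊥-elim (isZer⇒≢zer nz (row1-inner B 1≤c 1+c≤))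
  preserved (suc (suc r)) (_ , 1≤c , r+c≤) (down _) = (s≤s z≤n , 1≤c , <⇒≤ r+c≤) , ≤-refl
  preserved (suc (suc r)) (_ , 1≤c , r+c≤) (down-right _) =
    (s≤s z≤n , s≤s z≤n , subst (_≤ h + 3) (sym (cong suc (+-suc r c))) r+c≤) , ≤-refl

search-halts : ∀ {h L} K → Boundary h L → HaltsWithin (searchStep L K) (stepBound h) (searchStart h)
search-halts {h} {L} K B =
  halts-by-potential (searchStep L K) (SearchCell h) proj₁ (search-decreasing B) _ start
    (≤-trans (m≤m+n (h + 1) 2) (≤-trans start-sum (m≤n*m (h + 3) 3)))
  where
  start-sum : (h + 1) + 2 ≤ h + 3
  start-sum = ≤-reflexive (+-assoc h 1 2)
  start : SearchCell h (searchStart h)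
  start = m≤n+m 1 h , s≤s z≤n , start-sum

module _ {A : Set} {P : Pred A 0ℓ} (P? : Decidable P) where

  count : List A → ℕ
  count xs = length (filter P? xs)

  count-∷ : ∀ x xs → count xs ≤ count (x ∷ xs)
  count-∷ x xs with P? x
  ... | yes _ = n≤1+n _
  ... | no _  = ≤-refl

  count-++ : ∀ xs ys → count (xs ++ ys) ≡ count xs + count ys
  count-++ xs ys = trans (cong length (filter-++ P? xs ys)) (length-++ (filter P? xs))

  count-applyUpTo : ∀ f j {k n} → j + k ≤ n → (∀ {i} → i < k → P (f (j + i))) → k ≤ count (applyUpTo f n)
  count-applyUpTo f zero {zero} _ _ = z≤n
  count-applyUpTo f zero {suc k} {suc n} (s≤s k≤n) Pf
    rewrite filter-accept P? {xs = applyUpTo (f ∘ suc) n} (Pf z<s) =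
    s≤s (count-applyUpTo (f ∘ suc) zero k≤n (Pf ∘ s<s))
  count-applyUpTo f (suc j) {n = suc n} (s≤s j+k≤n) Pf =
    ≤-trans (count-applyUpTo (f ∘ suc) j j+k≤n Pf) (count-∷ (f 0) (applyUpTo (f ∘ suc) n))

  module _ {B : Set} (G : B → List A) where

    count-concatMap : ∀ (b : B → ℕ) {xs} → List.All (λ x → b x ≤ count (G x)) xs →
                      sum (map b xs) ≤ count (concatMap G xs)
    count-concatMap b List.[] = z≤n
    count-concatMap b {x ∷ xs} (bx≤ List.∷ bxs≤) rewrite count-++ (G x) (concatMap G xs) =
      +-mono-≤ bx≤ (count-concatMap b bxs≤)

    count-concatMap-∈ : ∀ {x xs} → x ∈ xs → count (G x) ≤ count (concatMap G xs)
    count-concatMap-∈ {xs = y ∷ ys} x∈ rewrite count-++ (G y) (concatMap G ys) with x∈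
    ... | here refl = m≤m+n _ _
    ... | there x∈ys = ≤-trans (count-concatMap-∈ x∈ys) (m≤n+m _ _)

sum-applyUpTo-mono : ∀ (f : ℕ → ℕ) {m n} → m ≤ n → sum (applyUpTo f m) ≤ sum (applyUpTo f n)
sum-applyUpTo-mono f z≤n = z≤n
sum-applyUpTo-mono f (s≤s m≤n) = +-monoʳ-≤ (f 0) (sum-applyUpTo-mono (f ∘ suc) m≤n)

triangle : ℕ → ℕ
triangle k = sum (applyUpTo (k ∸_) (suc k))

triangle-closed : ∀ k → 2 * triangle k ≡ k * suc k
triangle-closed zero = refl
triangle-closed (suc k) = begin
  2 * (suc k + triangle k)    ≡⟨ *-distribˡ-+ 2 (suc k) (triangle k) ⟩
  2 * suc k + 2 * triangle k  ≡⟨ cong (2 * suc k +_) (triangle-closed k) ⟩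
  2 * suc k + k * suc k       ≡⟨ gauss-step k ⟩
  suc k * suc (suc k)         ∎
  where
  open ≡-Reasoning
  gauss-step : ∀ k → 2 * suc k + k * suc k ≡ suc k * suc (suc k)
  gauss-step = solve-∀

keyCount : Filling → List (ℕ × ℕ) → ℕ
keyCount L = count (λ rc → T? (isKey (L (proj₁ rc) (proj₂ rc))))

-- rowCells h r is row r + 1 of the diagram, listed as in the definition of cells
rowCells : ℕ → ℕ → List (ℕ × ℕ)
rowCells h r = map (λ c → (suc r , suc c)) (upTo (h + 3 ∸ r))

key-cell-below-diagonal : ∀ {h m r c} → 2 ≤ r → 2 ≤ c → r + c ≤ h + 2 → KeyCell h m r c
key-cell-below-diagonal {h} 2≤r 2≤c r+c≤h+2 =
  2≤r , 2≤c , ≤-trans r+c≤h+2 (+-monoʳ-≤ h (n≤1+n 2)) ,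
  λ (r+c≡h+3 , _) → <-irrefl r+c≡h+3 (≤-trans (s≤s r+c≤h+2) (≤-reflexive (sym (+-suc h 2))))

-- condition (3) puts at most h − 1 ∞'s on diagonal h + 2, all of them away from its head
head-key-cell : ∀ {h m} → m < h → KeyCell h m (suc h) 2
head-key-cell {h} {m} m<h =
  s≤s (≤-trans z<s m<h) , ≤-refl , ≤-reflexive (sym (+-suc h 2)) ,
  λ (_ , h+2∸m≤2) → <-irrefl refl (≤-trans 3≤h+2∸m h+2∸m≤2)
  where
  3≤h+2∸m : 3 ≤ h + 2 ∸ m
  3≤h+2∸m rewrite +-∸-comm {h} 2 {m} (<⇒≤ m<h) = +-monoˡ-≤ 2 (m<n⇒0<n∸m m<h)

module _ {h m L} (I : IsLDSWith h m L) where
  open IsLDSWith I using (keys; m<h)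

  isKey-cell : ∀ {r c} → KeyCell h m r c → T (isKey (L r c))
  isKey-cell {r} {c} kc with keys r c kc
  ... | _ , _ , Lrc≡key rewrite Lrc≡key = tt

  row-keys : ∀ r d → r + d < h → d ≤ keyCount L (rowCells h (suc r))
  row-keys r d r+d<h = subst (d ≤_) (cong (keyCount L) (sym (map-upTo _ (h + 3 ∸ suc r))))
                              (count-applyUpTo _ _ 1 (m+n≤o⇒m≤o∸n (1 + d) fits) keys-left)
    where
    fits : 1 + d + suc r ≤ h + 3
    fits = begin
      1 + d + suc r    ≡⟨ regroup r d ⟩
      suc (r + d) + 1  ≤⟨ +-monoˡ-≤ 1 r+d<h ⟩
      h + 1            ≤⟨ +-monoʳ-≤ h (s≤s z≤n) ⟩
      h + 3            ∎
      where
      open ≤-Reasoning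
      regroup : ∀ r d → 1 + d + suc r ≡ suc (r + d) + 1
      regroup = solve-∀
    keys-left : ∀ {i} → i < d → T (isKey (L (suc (suc r)) (suc (suc i))))
    keys-left {i} i<d = isKey-cell (key-cell-below-diagonal {m = m} (s≤s (s≤s z≤n)) (s≤s (s≤s z≤n))
      (≤-trans (≤-reflexive (regroup r i)) (+-monoˡ-≤ 2 (≤-trans (s≤s (+-monoʳ-< r i<d)) r+d<h))))
      where
      regroup : ∀ r i → 2 + r + (2 + i) ≡ suc (suc (r + i)) + 2
      regroup = solve-∀

  head-row-key : 1 ≤ keyCount L (rowCells h h)
  head-row-key = subst (1 ≤_) (cong (keyCount L) (sym (map-upTo _ (h + 3 ∸ h))))
                       (count-applyUpTo _ _ 1 (≤-trans (s≤s (s≤s z≤n)) (≤-reflexive (sym (m+n∸m≡n h 3))))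
                         λ { z<s → isKey-cell (head-key-cell m<h) })

  one≤numKeys : 1 ≤ numKeys h L
  one≤numKeys = ≤-trans head-row-key
    (count-concatMap-∈ _ (rowCells h) (∈-upTo⁺ (m<m+n h {3} z<s)))

triangle≤numKeys : ∀ {k m L} → IsLDSWith (suc k) m L → triangle k ≤ numKeys (suc k) L
triangle≤numKeys {k} {L = L} I = begin
  sum (applyUpTo (k ∸_) (suc k))                ≤⟨ sum-applyUpTo-mono (k ∸_) (m<m+n k z<s) ⟩
  sum (applyUpTo (k ∸_) (k + 3))                ≡⟨ cong sum (sym (map-upTo rowBound (suc k + 3))) ⟩
  sum (map rowBound (upTo (suc k + 3)))         ≤⟨ count-concatMap _ (rowCells (suc k)) rowBound
                                                     (applyUpTo⁺₁ id (suc k + 3) row-bound) ⟩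
  numKeys (suc k) L                             ∎
  where
  open ≤-Reasoning
  rowBound : ℕ → ℕ
  rowBound zero    = 0
  rowBound (suc r) = k ∸ r
  row-bound : ∀ {i} → i < suc k + 3 → rowBound i ≤ keyCount L (rowCells (suc k) i)
  row-bound {zero}  _ = z≤n
  row-bound {suc r} _ with r ≤? k
  ... | yes r≤k = row-keys I r (k ∸ r) (s≤s (≤-reflexive (m+[n∸m]≡n r≤k)))
  ... | no r≰k  = ≤-trans (≤-reflexive (m≤n⇒m∸n≡0 (<⇒≤ (≰⇒> r≰k)))) z≤n

height²≤4*numKeys : ∀ {h m L} → IsLDSWith h m L → h * h ≤ 4 * numKeys h L
height²≤4*numKeys {zero}      _ = z≤n
height²≤4*numKeys {suc k} {L = L} I = begin
  suc k + k * suc k        ≡⟨ cong (suc k +_) (sym (triangle-closed k)) ⟩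
  suc k + 2 * triangle k   ≤⟨ +-mono-≤ (+-mono-≤ (one≤numKeys I) (≤-trans (m≤m+n k _) T≤N))
                                      (*-monoʳ-≤ 2 T≤N) ⟩
  (N + N) + 2 * N          ≡⟨ collect N ⟩
  4 * N                    ∎
  where
  open ≤-Reasoning
  N = numKeys (suc k) L
  T≤N : triangle k ≤ N
  T≤N = triangle≤numKeys I
  collect : ∀ N → (N + N) + 2 * N ≡ 4 * N
  collect = solve-∀

stepBound≤12*h : ∀ {h} → 1 ≤ h → stepBound h ≤ 12 * h
stepBound≤12*h {h} 1≤h = begin
  3 * (h + 3)    ≡⟨ expand h ⟩
  3 * h + 9 * 1  ≤⟨ +-monoʳ-≤ (3 * h) (*-monoʳ-≤ 9 1≤h) ⟩
  3 * h + 9 * h  ≡⟨ collect h ⟩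
  12 * h         ∎
  where
  open ≤-Reasoning
  expand : ∀ h → 3 * (h + 3) ≡ 3 * h + 9 * 1
  expand = solve-∀
  collect : ∀ h → 3 * h + 9 * h ≡ 12 * h
  collect = solve-∀

stepBound²≤576*numKeys : ∀ {h m L} → IsLDSWith h m L → stepBound h * stepBound h ≤ 576 * numKeys h L
stepBound²≤576*numKeys {h} {L = L} I = begin
  stepBound h * stepBound h  ≤⟨ *-mono-≤ stepBound≤12h stepBound≤12h ⟩
  12 * h * (12 * h)          ≡⟨ square-12h h ⟩
  144 * (h * h)              ≤⟨ *-monoʳ-≤ 144 (height²≤4*numKeys I) ⟩
  144 * (4 * numKeys h L)    ≡⟨ *-assoc 144 4 (numKeys h L) ⟨
  576 * numKeys h L          ∎
  where
  open ≤-Reasoning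
  stepBound≤12h : stepBound h ≤ 12 * h
  stepBound≤12h = stepBound≤12*h (≤-trans (s≤s z≤n) (IsLDSWith.m<h I))
  square-12h : ∀ h → 12 * h * (12 * h) ≡ 144 * (h * h)
  square-12h = solve-∀

theorem2 : Σ ℕ λ a →
    ∀ h (L : Filling) → IsLDS h L →
      ((∀ K → 0 < K →
          Σ ℕ λ n → HaltsWithin (searchStep L K) n (searchStart h) × (n * n ≤ a * numKeys h L))
      × (∀ r c → ValidStart h r c →
          Σ ℕ λ n → HaltsWithin inwardStep n (L , r , c) × (n * n ≤ a * numKeys h L))
      × (∀ r c → ValidStart h r c →
          Σ ℕ λ n → HaltsWithin outwardStep n (L , r , c) × (n * n ≤ a * numKeys h L)))
theorem2 = 576 , λ h L (_ , I) →
  let B = boundary I in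
    -- SearchLDS stays within the bound for every K
    (λ K _   → stepBound h , search-halts K B  , stepBound²≤576*numKeys I)
  , (λ _ _ v → stepBound h , inward-halts B v  , stepBound²≤576*numKeys I)
  , (λ _ _ v → stepBound h , outward-halts B v , stepBound²≤576*numKeys I)
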